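{- Let $k$ be an even integer and $G=\{0,1,\dots,k-2\}$. There is no balanced pairwise independent distribution on $G^k$ such that every $(x_1,\dots,x_k)$ in its support has an odd number of coordinates equal to $0$.
   Context: A distribution $\mu$ on $G^k$ is balanced pairwise independent if for $x\sim\mu$, $\Pr[x_i=g]=1/|G|$ for all $i$ and $g\in G$, and $\Pr[x_i=g,x_j=g']=1/|G|^2$ for all $i\neq j$ and $g,g'\in G$.
   Formalization: The point masses of the distributions on $G^k$ are taken in the rationals. -}

module Defs where

open import Data.Nat using (ℕ; zero; suc; _∸_) renaming (_≟_ to _ℕ≟_; _+_ to _ℕ+_)
open import Data.Fin using (Fin; zero; suc; _≟_; toℕ)
open import Data.Vec.Functional using (_∷_)
open import Data.Rational using (ℚ; 0ℚ; 1ℚ; _+_; _*_; _≤_; _/_)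
open import Data.Integer using (+_)
open import Data.Product using (_×_)
open import Data.Bool using (if_then_else_)
open import Relation.Nullary using (does)
open import Relation.Binary.PropositionalEquality using (_≡_; _≢_)

G : ℕ → Set
G k = Fin (k ∸ 1)

Point : ℕ → Set
Point k = Fin k → G k

sumFin : (m : ℕ) → (Fin m → ℚ) → ℚ
sumFin zero    f = 0ℚ
sumFin (suc m) f = f zero + sumFin m (λ i → f (suc i))

sumFun : (n m : ℕ) → ((Fin n → Fin m) → ℚ) → ℚ
sumFun zero    m f = f (λ ())
sumFun (suc n) m f = sumFin m (λ a → sumFun n m (λ x → f (a ∷ x)))

fromℕ : ℕ → ℚ
fromℕ n = + n / 1

record Distribution (k : ℕ) : Set where
  field
    μ       : Point k → ℚ
    nonneg  : ∀ x → 0ℚ ≤ μ x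
    total   : sumFun k (k ∸ 1) μ ≡ fromℕ 1

Pr₁ : ∀ {k} → Distribution k → Fin k → G k → ℚ
Pr₁ {k} D i g = sumFun k (k ∸ 1) (λ x → if does (x i ≟ g) then Distribution.μ D x else 0ℚ)

Pr₂ : ∀ {k} → Distribution k → Fin k → G k → Fin k → G k → ℚ
Pr₂ {k} D i g j g' = sumFun k (k ∸ 1)
  (λ x → if does (x i ≟ g) then (if does (x j ≟ g') then Distribution.μ D x else 0ℚ) else 0ℚ)

-- balanced pairwise independent (written as |G|·Pr = 1 and |G|²·Pr = 1,
-- i.e. Pr = 1/|G| and Pr = 1/|G|², avoiding division)
BalancedPairwiseIndependent : ∀ {k} → Distribution k → Set
BalancedPairwiseIndependent {k} D =
  (∀ (i : Fin k) (g : G k) → fromℕ (k ∸ 1) * Pr₁ D i g ≡ fromℕ 1)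
  × (∀ (i j : Fin k) → i ≢ j → ∀ (g g' : G k) →
       fromℕ (k ∸ 1) * fromℕ (k ∸ 1) * Pr₂ D i g j g' ≡ fromℕ 1)

countZeros : ∀ {n m} → (Fin n → Fin m) → ℕ
countZeros {zero}  x = 0
countZeros {suc n} x = (if does (toℕ (x zero) ℕ≟ 0) then 1 else 0) ℕ+ countZeros (λ i → x (suc i))

{-# OPTIONS --safe #-}

-- Let Z be the number of coordinates equal to 0 and q = k - 1 = |G|. Pairwise independence
-- fixes the first two moments of Z: q 𝔼[Z] = k and q² 𝔼[Z²] = k (k + q - 1). Since k = q + 1,
-- this gives q² 𝔼[(Z - 1)(q - Z)] = -q < 0. On the support, however, Z is odd and k is even,
-- so 1 ≤ Z ≤ k - 1 = q and (Z - 1)(q - Z) ≥ 0.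

module Submission where

open import Defs
open import Data.Bool using (Bool; true; false; if_then_else_)
open import Data.Fin using (Fin; zero; suc; _≟_; toℕ)
import Data.Integer as ℤ
import Data.Integer.Properties as ℤₚ
open import Data.Nat as ℕ using (ℕ; zero; suc; _∸_) renaming (_≟_ to _ℕ≟_)
import Data.Nat.Properties as ℕₚ
open import Data.Nat.Coprimality using (1-coprimeTo) renaming (sym to coprime-sym)
open import Data.Nat.Divisibility using (_∣_; _∣0; ∣1⇒≡1)
open import Data.Product using (Σ; _×_; _,_; proj₁; proj₂)
open import Data.Rational using (ℚ; 0ℚ; 1ℚ; _+_; _*_; -_; _-_; _≤_; mkℚ; Positive; nonNegative)
import Data.Rational.Properties as ℚₚ
open import Data.Rational.Solver using (module +-*-Solver)
open import Data.Vec.Functional using (_∷_)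
open import Relation.Nullary using (¬_; does; yes; no)
open import Relation.Binary.PropositionalEquality

open +-*-Solver
open ≡-Reasoning

fromℕ≡mkℚ : ∀ n → fromℕ n ≡ mkℚ (ℤ.+ n) 0 (coprime-sym (1-coprimeTo n))
fromℕ≡mkℚ n = ℚₚ.normalize-coprime (coprime-sym (1-coprimeTo n))

fromℕ-+ : ∀ m n → fromℕ (m ℕ.+ n) ≡ fromℕ m + fromℕ n
-- In normal form the sum computes to (m·1 + n·1)/(1·1).
fromℕ-+ m n rewrite fromℕ≡mkℚ m | fromℕ≡mkℚ n = ℚₚ./-cong {ℤ.+ (m ℕ.+ n)} {1} numerators refl
  where
  numerators : ℤ.+ (m ℕ.+ n) ≡ ℤ.+ m ℤ.* ℤ.+ 1 ℤ.+ ℤ.+ n ℤ.* ℤ.+ 1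
  numerators = trans (ℤₚ.pos-+ m n)
    (sym (cong₂ ℤ._+_ (ℤₚ.*-identityʳ (ℤ.+ m)) (ℤₚ.*-identityʳ (ℤ.+ n))))

fromℕ-∸ : ∀ {m n} → n ℕ.≤ m → fromℕ (m ∸ n) ≡ fromℕ m - fromℕ n
fromℕ-∸ {m} {n} n≤m = begin
  fromℕ (m ∸ n)
    ≡⟨ solve 2 (λ a b → b := (a :+ b) :- a) refl (fromℕ n) (fromℕ (m ∸ n)) ⟩
  (fromℕ n + fromℕ (m ∸ n)) - fromℕ n
    ≡⟨ cong (_- fromℕ n) (sym (fromℕ-+ n (m ∸ n))) ⟩
  fromℕ (n ℕ.+ (m ∸ n)) - fromℕ n
    ≡⟨ cong (λ a → fromℕ a - fromℕ n) (ℕₚ.m+[n∸m]≡n n≤m) ⟩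
  fromℕ m - fromℕ n ∎

fromℕ-nonNeg : ∀ n → 0ℚ ≤ fromℕ n
fromℕ-nonNeg n = ℚₚ.nonNegative⁻¹ (fromℕ n) {{ℚₚ.normalize-nonNeg n 1}}

*-nonNeg : ∀ {p r} → 0ℚ ≤ p → 0ℚ ≤ r → 0ℚ ≤ p * r
*-nonNeg {p} {r} 0≤p 0≤r =
  ℚₚ.nonNegative⁻¹ (p * r) {{ℚₚ.nonNeg*nonNeg⇒nonNeg p {{nonNegative 0≤p}} r {{nonNegative 0≤r}}}}

1≤c≤n⇒0≤[c-1][n-c] : ∀ {c n} → 1 ℕ.≤ c → c ℕ.≤ n →
  0ℚ ≤ (fromℕ c - 1ℚ) * (fromℕ n - fromℕ c)
1≤c≤n⇒0≤[c-1][n-c] {c} {n} 1≤c c≤n =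
  subst (0ℚ ≤_) (cong₂ _*_ (fromℕ-∸ 1≤c) (fromℕ-∸ c≤n))
    (*-nonNeg (fromℕ-nonNeg (c ∸ 1)) (fromℕ-nonNeg (n ∸ c)))

sumFin-cong : ∀ n {f f′ : Fin n → ℚ} → (∀ i → f i ≡ f′ i) → sumFin n f ≡ sumFin n f′
sumFin-cong zero    f≗f′ = refl
sumFin-cong (suc n) f≗f′ = cong₂ _+_ (f≗f′ zero) (sumFin-cong n (λ i → f≗f′ (suc i)))

sumFin-+ : ∀ n (f f′ : Fin n → ℚ) → sumFin n (λ i → f i + f′ i) ≡ sumFin n f + sumFin n f′
sumFin-+ zero    f f′ = refl
sumFin-+ (suc n) f f′ = begin
  (f zero + f′ zero) + sumFin n (λ i → f (suc i) + f′ (suc i))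
    ≡⟨ cong ((f zero + f′ zero) +_) (sumFin-+ n (λ i → f (suc i)) (λ i → f′ (suc i))) ⟩
  (f zero + f′ zero) + (F + F′)
    ≡⟨ solve 4 (λ a b c d → (a :+ b) :+ (c :+ d) := (a :+ c) :+ (b :+ d))
         refl (f zero) (f′ zero) F F′ ⟩
  (f zero + F) + (f′ zero + F′) ∎
  where
  F  = sumFin n (λ i → f (suc i))
  F′ = sumFin n (λ i → f′ (suc i))

*-distribˡ-sumFin : ∀ n c (f : Fin n → ℚ) → c * sumFin n f ≡ sumFin n (λ i → c * f i)
*-distribˡ-sumFin zero    c f = ℚₚ.*-zeroʳ c
*-distribˡ-sumFin (suc n) c f =
  trans (ℚₚ.*-distribˡ-+ c _ _) (cong (c * f zero +_) (*-distribˡ-sumFin n c (λ i → f (suc i))))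

*-distribʳ-sumFin : ∀ n c (f : Fin n → ℚ) → sumFin n f * c ≡ sumFin n (λ i → f i * c)
*-distribʳ-sumFin n c f = trans (ℚₚ.*-comm (sumFin n f) c)
  (trans (*-distribˡ-sumFin n c f) (sumFin-cong n (λ i → ℚₚ.*-comm c (f i))))

sumFin-*-sumFin : ∀ n (f f′ : Fin n → ℚ) →
  sumFin n f * sumFin n f′ ≡ sumFin n (λ i → sumFin n (λ j → f i * f′ j))
sumFin-*-sumFin n f f′ = trans (*-distribʳ-sumFin n (sumFin n f′) f)
  (sumFin-cong n (λ i → *-distribˡ-sumFin n (f i) f′))

sumFin-zero : ∀ n → sumFin n (λ _ → 0ℚ) ≡ 0ℚ
sumFin-zero zero    = refl
sumFin-zero (suc n) = trans (ℚₚ.+-identityˡ _) (sumFin-zero n)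

sumFin-const : ∀ n c → sumFin n (λ _ → c) ≡ fromℕ n * c
sumFin-const zero    c = sym (ℚₚ.*-zeroˡ c)
sumFin-const (suc n) c = begin
  c + sumFin n (λ _ → c) ≡⟨ cong (c +_) (sumFin-const n c) ⟩
  c + fromℕ n * c        ≡⟨ solve 2 (λ c a → c :+ a :* c := (con 1ℚ :+ a) :* c) refl c (fromℕ n) ⟩
  (1ℚ + fromℕ n) * c     ≡⟨ cong (_* c) (sym (fromℕ-+ 1 n)) ⟩
  fromℕ (suc n) * c      ∎

sumFin-δ : ∀ n (i : Fin n) c → sumFin n (λ j → if does (i ≟ j) then c else 0ℚ) ≡ c
sumFin-δ (suc n) zero    c = trans (cong (c +_) (sumFin-zero n)) (ℚₚ.+-identityʳ c)
sumFin-δ (suc n) (suc i) c = trans (ℚₚ.+-identityˡ _) (sumFin-δ n i c)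

sumFin-nonNeg : ∀ n (f : Fin n → ℚ) → (∀ i → 0ℚ ≤ f i) → 0ℚ ≤ sumFin n f
sumFin-nonNeg zero    f 0≤f = ℚₚ.≤-refl
sumFin-nonNeg (suc n) f 0≤f =
  ℚₚ.+-mono-≤ (0≤f zero) (sumFin-nonNeg n (λ i → f (suc i)) (λ i → 0≤f (suc i)))

sumFun-cong : ∀ n m {f f′ : (Fin n → Fin m) → ℚ} → (∀ x → f x ≡ f′ x) →
  sumFun n m f ≡ sumFun n m f′
sumFun-cong zero    m f≗f′ = f≗f′ _
sumFun-cong (suc n) m f≗f′ = sumFin-cong m (λ a → sumFun-cong n m (λ x → f≗f′ (a ∷ x)))

sumFun-+ : ∀ n m (f f′ : (Fin n → Fin m) → ℚ) →
  sumFun n m (λ x → f x + f′ x) ≡ sumFun n m f + sumFun n m f′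
sumFun-+ zero    m f f′ = refl
sumFun-+ (suc n) m f f′ = trans (sumFin-cong m (λ a → sumFun-+ n m _ _)) (sumFin-+ m _ _)

*-distribˡ-sumFun : ∀ n m c (f : (Fin n → Fin m) → ℚ) →
  c * sumFun n m f ≡ sumFun n m (λ x → c * f x)
*-distribˡ-sumFun zero    m c f = refl
*-distribˡ-sumFun (suc n) m c f =
  trans (*-distribˡ-sumFin m c _) (sumFin-cong m (λ a → *-distribˡ-sumFun n m c _))

sumFun-zero : ∀ n m → sumFun n m (λ _ → 0ℚ) ≡ 0ℚ
sumFun-zero zero    m = refl
sumFun-zero (suc n) m = trans (sumFin-cong m (λ _ → sumFun-zero n m)) (sumFin-zero m)

sumFun-sumFin-comm : ∀ n m k (h : (Fin n → Fin m) → Fin k → ℚ) →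
  sumFun n m (λ x → sumFin k (h x)) ≡ sumFin k (λ i → sumFun n m (λ x → h x i))
sumFun-sumFin-comm n m zero    h = sumFun-zero n m
sumFun-sumFin-comm n m (suc k) h = trans (sumFun-+ n m _ _)
  (cong (sumFun n m (λ x → h x zero) +_) (sumFun-sumFin-comm n m k (λ x i → h x (suc i))))

sumFun-nonNeg : ∀ n m (f : (Fin n → Fin m) → ℚ) → (∀ x → 0ℚ ≤ f x) → 0ℚ ≤ sumFun n m f
sumFun-nonNeg zero    m f 0≤f = 0≤f _
sumFun-nonNeg (suc n) m f 0≤f =
  sumFin-nonNeg m _ (λ a → sumFun-nonNeg n m _ (λ x → 0≤f (a ∷ x)))

𝟙[_] : Bool → ℚ
𝟙[ b ] = if b then 1ℚ else 0ℚ

𝟙-idem : ∀ b → 𝟙[ b ] * 𝟙[ b ] ≡ 𝟙[ b ]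
𝟙-idem true  = refl
𝟙-idem false = refl

if-then-0≡*𝟙 : ∀ b p → (if b then p else 0ℚ) ≡ p * 𝟙[ b ]
if-then-0≡*𝟙 true  p = sym (ℚₚ.*-identityʳ p)
if-then-0≡*𝟙 false p = sym (ℚₚ.*-zeroʳ p)

if-if-then-0≡*𝟙𝟙 : ∀ b c p →
  (if b then (if c then p else 0ℚ) else 0ℚ) ≡ p * (𝟙[ b ] * 𝟙[ c ])
if-if-then-0≡*𝟙𝟙 true  c p =
  trans (if-then-0≡*𝟙 c p) (cong (p *_) (sym (ℚₚ.*-identityˡ 𝟙[ c ])))
if-if-then-0≡*𝟙𝟙 false c p = sym (trans (cong (p *_) (ℚₚ.*-zeroˡ 𝟙[ c ])) (ℚₚ.*-zeroʳ p))

module Moments {k} (D : Distribution k) (g : G k) where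
  open Distribution D

  private
    m : ℕ
    m = k ∸ 1

  𝔼 : (Point k → ℚ) → ℚ
  𝔼 f = sumFun k m (λ x → μ x * f x)

  hit : Point k → Fin k → ℚ
  hit x i = 𝟙[ does (x i ≟ g) ]

  hits : Point k → ℚ
  hits x = sumFin k (hit x)

  𝔼-cong : ∀ {f f′} → (∀ x → f x ≡ f′ x) → 𝔼 f ≡ 𝔼 f′
  𝔼-cong f≗f′ = sumFun-cong k m (λ x → cong (μ x *_) (f≗f′ x))

  𝔼-+ : ∀ f f′ → 𝔼 (λ x → f x + f′ x) ≡ 𝔼 f + 𝔼 f′
  𝔼-+ f f′ = trans (sumFun-cong k m (λ x → ℚₚ.*-distribˡ-+ (μ x) (f x) (f′ x)))
    (sumFun-+ k m _ _)

  𝔼-* : ∀ c f → 𝔼 (λ x → c * f x) ≡ c * 𝔼 f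
  𝔼-* c f = trans
    (sumFun-cong k m (λ x → solve 3 (λ u c a → u :* (c :* a) := c :* (u :* a)) refl (μ x) c (f x)))
    (sym (*-distribˡ-sumFun k m c _))

  𝔼-const : ∀ c → 𝔼 (λ _ → c) ≡ c
  𝔼-const c = begin
    𝔼 (λ _ → c)      ≡⟨ 𝔼-cong (λ _ → sym (ℚₚ.*-identityʳ c)) ⟩
    𝔼 (λ _ → c * 1ℚ) ≡⟨ 𝔼-* c (λ _ → 1ℚ) ⟩
    c * 𝔼 (λ _ → 1ℚ) ≡⟨ cong (c *_) (trans (sumFun-cong k m (λ x → ℚₚ.*-identityʳ (μ x))) total) ⟩
    c * 1ℚ           ≡⟨ ℚₚ.*-identityʳ c ⟩
    c                ∎

  𝔼-quadratic : ∀ a b c (Z : Point k → ℚ) →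
    𝔼 (λ x → a * (Z x * Z x) + (b * Z x + c)) ≡ a * 𝔼 (λ x → Z x * Z x) + (b * 𝔼 Z + c)
  𝔼-quadratic a b c Z = begin
    𝔼 (λ x → a * (Z x * Z x) + (b * Z x + c))
      ≡⟨ 𝔼-+ (λ x → a * (Z x * Z x)) (λ x → b * Z x + c) ⟩
    𝔼 (λ x → a * (Z x * Z x)) + 𝔼 (λ x → b * Z x + c)
      ≡⟨ cong₂ _+_ (𝔼-* a (λ x → Z x * Z x)) (𝔼-+ (λ x → b * Z x) (λ _ → c)) ⟩
    a * 𝔼 (λ x → Z x * Z x) + (𝔼 (λ x → b * Z x) + 𝔼 (λ _ → c))
      ≡⟨ cong (λ e → a * 𝔼 (λ x → Z x * Z x) + e) (cong₂ _+_ (𝔼-* b Z) (𝔼-const c)) ⟩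
    a * 𝔼 (λ x → Z x * Z x) + (b * 𝔼 Z + c) ∎

  𝔼-sumFin : ∀ (h : Point k → Fin k → ℚ) →
    𝔼 (λ x → sumFin k (h x)) ≡ sumFin k (λ i → 𝔼 (λ x → h x i))
  𝔼-sumFin h = trans (sumFun-cong k m (λ x → *-distribˡ-sumFin k (μ x) (h x)))
    (sumFun-sumFin-comm k m k (λ x i → μ x * h x i))

  𝔼-nonNeg : ∀ f → (∀ x → μ x ≢ 0ℚ → 0ℚ ≤ f x) → 0ℚ ≤ 𝔼 f
  𝔼-nonNeg f 0≤f-on-support = sumFun-nonNeg k m _ 0≤μf
    where
    0≤μf : ∀ x → 0ℚ ≤ μ x * f x
    0≤μf x with μ x ℚₚ.≟ 0ℚ
    ... | yes μx≡0 = ℚₚ.≤-reflexive (sym (trans (cong (_* f x) μx≡0) (ℚₚ.*-zeroˡ (f x))))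
    ... | no  μx≢0 = *-nonNeg (nonneg x) (0≤f-on-support x μx≢0)

  Pr₁≡𝔼[hit] : ∀ i → Pr₁ D i g ≡ 𝔼 (λ x → hit x i)
  Pr₁≡𝔼[hit] i = sumFun-cong k m (λ x → if-then-0≡*𝟙 (does (x i ≟ g)) (μ x))

  Pr₂≡𝔼[hit*hit] : ∀ i j → Pr₂ D i g j g ≡ 𝔼 (λ x → hit x i * hit x j)
  Pr₂≡𝔼[hit*hit] i j =
    sumFun-cong k m (λ x → if-if-then-0≡*𝟙𝟙 (does (x i ≟ g)) (does (x j ≟ g)) (μ x))

  𝔼[hits]≡ΣPr₁ : 𝔼 hits ≡ sumFin k (λ i → Pr₁ D i g)
  𝔼[hits]≡ΣPr₁ = trans (𝔼-sumFin hit) (sumFin-cong k (λ i → sym (Pr₁≡𝔼[hit] i)))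

  𝔼[hits²]≡ΣΣ𝔼[hit*hit] :
    𝔼 (λ x → hits x * hits x) ≡ sumFin k (λ i → sumFin k (λ j → 𝔼 (λ x → hit x i * hit x j)))
  𝔼[hits²]≡ΣΣ𝔼[hit*hit] = begin
    𝔼 (λ x → hits x * hits x)
      ≡⟨ 𝔼-cong (λ x → sumFin-*-sumFin k (hit x) (hit x)) ⟩
    𝔼 (λ x → sumFin k (λ i → sumFin k (λ j → hit x i * hit x j)))
      ≡⟨ 𝔼-sumFin _ ⟩
    sumFin k (λ i → 𝔼 (λ x → sumFin k (λ j → hit x i * hit x j)))
      ≡⟨ sumFin-cong k (λ i → 𝔼-sumFin _) ⟩
    sumFin k (λ i → sumFin k (λ j → 𝔼 (λ x → hit x i * hit x j))) ∎

module _ {k} (D : Distribution k) (balanced : BalancedPairwiseIndependent D) (g : G k) where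
  open Moments D g

  private
    q : ℚ
    q = fromℕ (k ∸ 1)

  balanced⇒q*𝔼[hits]≡k : q * 𝔼 hits ≡ fromℕ k
  balanced⇒q*𝔼[hits]≡k = begin
    q * 𝔼 hits                      ≡⟨ cong (q *_) 𝔼[hits]≡ΣPr₁ ⟩
    q * sumFin k (λ i → Pr₁ D i g)  ≡⟨ *-distribˡ-sumFin k q _ ⟩
    sumFin k (λ i → q * Pr₁ D i g)  ≡⟨ sumFin-cong k (λ i → proj₁ balanced i g) ⟩
    sumFin k (λ _ → 1ℚ)             ≡⟨ sumFin-const k 1ℚ ⟩
    fromℕ k * 1ℚ                    ≡⟨ ℚₚ.*-identityʳ (fromℕ k) ⟩
    fromℕ k                         ∎

  balanced⇒q²*𝔼[hit*hit]≡1+δ[q-1] : ∀ i j →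
    q * q * 𝔼 (λ x → hit x i * hit x j) ≡ 1ℚ + (if does (i ≟ j) then q - 1ℚ else 0ℚ)
  balanced⇒q²*𝔼[hit*hit]≡1+δ[q-1] i j with i ≟ j
  ... | yes refl = begin
    q * q * 𝔼 (λ x → hit x i * hit x i)
      ≡⟨ cong (q * q *_) (𝔼-cong (λ x → 𝟙-idem (does (x i ≟ g)))) ⟩
    q * q * 𝔼 (λ x → hit x i)
      ≡⟨ ℚₚ.*-assoc q q _ ⟩
    q * (q * 𝔼 (λ x → hit x i))
      ≡⟨ cong (λ p → q * (q * p)) (sym (Pr₁≡𝔼[hit] i)) ⟩
    q * (q * Pr₁ D i g)
      ≡⟨ cong (q *_) (proj₁ balanced i g) ⟩
    q * 1ℚ
      ≡⟨ solve 1 (λ q → q :* con 1ℚ := con 1ℚ :+ (q :- con 1ℚ)) refl q ⟩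
    1ℚ + (q - 1ℚ) ∎
  ... | no i≢j = begin
    q * q * 𝔼 (λ x → hit x i * hit x j)
      ≡⟨ cong (q * q *_) (sym (Pr₂≡𝔼[hit*hit] i j)) ⟩
    q * q * Pr₂ D i g j g
      ≡⟨ proj₂ balanced i j i≢j g g ⟩
    1ℚ
      ≡⟨ sym (ℚₚ.+-identityʳ 1ℚ) ⟩
    1ℚ + 0ℚ ∎

  balanced⇒q²*𝔼[hits²]≡k[k+q-1] :
    q * q * 𝔼 (λ x → hits x * hits x) ≡ fromℕ k * (fromℕ k + (q - 1ℚ))
  balanced⇒q²*𝔼[hits²]≡k[k+q-1] = begin
    q * q * 𝔼 (λ x → hits x * hits x)
      ≡⟨ cong (q * q *_) 𝔼[hits²]≡ΣΣ𝔼[hit*hit] ⟩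
    q * q * sumFin k (λ i → sumFin k (λ j → 𝔼 (λ x → hit x i * hit x j)))
      ≡⟨ *-distribˡ-sumFin k (q * q) _ ⟩
    sumFin k (λ i → q * q * sumFin k (λ j → 𝔼 (λ x → hit x i * hit x j)))
      ≡⟨ sumFin-cong k (λ i → *-distribˡ-sumFin k (q * q) _) ⟩
    sumFin k (λ i → sumFin k (λ j → q * q * 𝔼 (λ x → hit x i * hit x j)))
      ≡⟨ sumFin-cong k (λ i → sumFin-cong k (balanced⇒q²*𝔼[hit*hit]≡1+δ[q-1] i)) ⟩
    sumFin k (λ i → sumFin k (λ j → 1ℚ + δ i j))
      ≡⟨ sumFin-cong k (λ i → sumFin-+ k (λ _ → 1ℚ) (δ i)) ⟩
    sumFin k (λ i → sumFin k (λ _ → 1ℚ) + sumFin k (δ i))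
      ≡⟨ sumFin-cong k (λ i → cong₂ _+_ Σ1≡k (sumFin-δ k i (q - 1ℚ))) ⟩
    sumFin k (λ _ → fromℕ k + (q - 1ℚ))
      ≡⟨ sumFin-const k _ ⟩
    fromℕ k * (fromℕ k + (q - 1ℚ)) ∎
    where
    δ : Fin k → Fin k → ℚ
    δ i j = if does (i ≟ j) then q - 1ℚ else 0ℚ
    Σ1≡k : sumFin k (λ _ → 1ℚ) ≡ fromℕ k
    Σ1≡k = trans (sumFin-const k 1ℚ) (ℚₚ.*-identityʳ (fromℕ k))

module _ {n} (D : Distribution (suc n)) (balanced : BalancedPairwiseIndependent D) (g : Fin n) where
  open Moments D g

  private
    q : ℚ
    q = fromℕ n

  balanced⇒q²*𝔼[[hits-1][q-hits]]≡-q : q * q * 𝔼 (λ x → (hits x - 1ℚ) * (q - hits x)) ≡ - q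
  balanced⇒q²*𝔼[[hits-1][q-hits]]≡-q = begin
    q * q * 𝔼 (λ x → (hits x - 1ℚ) * (q - hits x))
      ≡⟨ cong (q * q *_) (𝔼-cong (λ x → expand (hits x))) ⟩
    q * q * 𝔼 (λ x → (- 1ℚ) * (hits x * hits x) + ((1ℚ + q) * hits x + - q))
      ≡⟨ cong (q * q *_) (𝔼-quadratic (- 1ℚ) (1ℚ + q) (- q) hits) ⟩
    q * q * ((- 1ℚ) * 𝔼 (λ x → hits x * hits x) + ((1ℚ + q) * 𝔼 hits + - q))
      ≡⟨ solve 3 (λ q z² z → q :* q :* (con (- 1ℚ) :* z² :+ ((con 1ℚ :+ q) :* z :+ :- q))
           := con (- 1ℚ) :* (q :* q :* z²) :+ ((con 1ℚ :+ q) :* q :* (q :* z) :+ :- (q :* q :* q)))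
           refl q _ _ ⟩
    (- 1ℚ) * (q * q * 𝔼 (λ x → hits x * hits x)) + ((1ℚ + q) * q * (q * 𝔼 hits) + - (q * q * q))
      ≡⟨ cong₂ (λ a b → (- 1ℚ) * a + ((1ℚ + q) * q * b + - (q * q * q)))
           (balanced⇒q²*𝔼[hits²]≡k[k+q-1] D balanced g) (balanced⇒q*𝔼[hits]≡k D balanced g) ⟩
    (- 1ℚ) * (k * (k + (q - 1ℚ))) + ((1ℚ + q) * q * k + - (q * q * q))
      ≡⟨ cong (λ k → (- 1ℚ) * (k * (k + (q - 1ℚ))) + ((1ℚ + q) * q * k + - (q * q * q)))
           (fromℕ-+ 1 n) ⟩
    (- 1ℚ) * ((1ℚ + q) * ((1ℚ + q) + (q - 1ℚ))) + ((1ℚ + q) * q * (1ℚ + q) + - (q * q * q))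
      ≡⟨ solve 1 (λ q → con (- 1ℚ) :* ((con 1ℚ :+ q) :* ((con 1ℚ :+ q) :+ (q :- con 1ℚ)))
           :+ ((con 1ℚ :+ q) :* q :* (con 1ℚ :+ q) :+ :- (q :* q :* q)) := :- q) refl q ⟩
    - q ∎
    where
    k : ℚ
    k = fromℕ (suc n)
    expand : ∀ z → (z - 1ℚ) * (q - z) ≡ (- 1ℚ) * (z * z) + ((1ℚ + q) * z + - q)
    expand z = solve 2 (λ z q → (z :- con 1ℚ) :* (q :- z)
      := con (- 1ℚ) :* (z :* z) :+ ((con 1ℚ :+ q) :* z :+ :- q)) refl z q

sumFin-𝟙[≟zero]≡countZeros : ∀ {n m} (x : Fin n → Fin (suc m)) →
  sumFin n (λ i → 𝟙[ does (x i ≟ zero) ]) ≡ fromℕ (countZeros x)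
sumFin-𝟙[≟zero]≡countZeros {zero}  x = refl
sumFin-𝟙[≟zero]≡countZeros {suc n} x =
  trans (cong₂ _+_ (𝟙[≟zero] (x zero)) (sumFin-𝟙[≟zero]≡countZeros (λ i → x (suc i))))
        (sym (fromℕ-+ (if does (toℕ (x zero) ℕ≟ 0) then 1 else 0) (countZeros (λ i → x (suc i)))))
  where
  𝟙[≟zero] : ∀ {m} (y : Fin (suc m)) →
    𝟙[ does (y ≟ zero) ] ≡ fromℕ (if does (toℕ y ℕ≟ 0) then 1 else 0)
  𝟙[≟zero] zero    = refl
  𝟙[≟zero] (suc y) = refl

countZeros≤ : ∀ {n m} (x : Fin n → Fin m) → countZeros x ℕ.≤ n
countZeros≤ {zero}  x = ℕ.z≤n
countZeros≤ {suc n} x with does (toℕ (x zero) ℕ≟ 0)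
... | true  = ℕ.s≤s (countZeros≤ (λ i → x (suc i)))
... | false = ℕₚ.m≤n⇒m≤1+n (countZeros≤ (λ i → x (suc i)))

odd≤even⇒0<odd<even : ∀ {c m} → ¬ 2 ∣ c → 2 ∣ m → c ℕ.≤ m → 0 ℕ.< c × c ℕ.< m
odd≤even⇒0<odd<even odd even c≤m =
  ℕₚ.n≢0⇒n>0 (λ { refl → odd (2 ∣0) }) , ℕₚ.≤∧≢⇒< c≤m (λ { refl → odd even })

no-balanced-with-odd-support : ∀ {n} (D : Distribution (suc (suc n))) →
  BalancedPairwiseIndependent D → 2 ∣ suc (suc n) →
  ¬ (∀ x → Distribution.μ D x ≢ 0ℚ → ¬ 2 ∣ countZeros x)
no-balanced-with-odd-support {n} D balanced even odd-on-support =
  ℚₚ.nonNeg≢neg (q * q * 𝔼 parabola) (- q) {{nonNegative 0≤q²𝔼}} {{ℚₚ.neg-pos {q} q>0}}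
    (balanced⇒q²*𝔼[[hits-1][q-hits]]≡-q D balanced zero)
  where
  open Moments D zero
  q : ℚ
  q = fromℕ (suc n)
  q>0 : Positive q
  q>0 = ℚₚ.normalize-pos (suc n) 1
  parabola : Point (suc (suc n)) → ℚ
  parabola x = (hits x - 1ℚ) * (q - hits x)
  0≤parabola : ∀ x → Distribution.μ D x ≢ 0ℚ → 0ℚ ≤ parabola x
  0≤parabola x μx≢0 with odd≤even⇒0<odd<even (odd-on-support x μx≢0) even (countZeros≤ x)
  ... | 1≤c , c<k = subst (λ z → 0ℚ ≤ (z - 1ℚ) * (q - z)) (sym (sumFin-𝟙[≟zero]≡countZeros x))
                      (1≤c≤n⇒0≤[c-1][n-c] 1≤c (ℕ.s≤s⁻¹ c<k))
  0≤q²𝔼 : 0ℚ ≤ q * q * 𝔼 parabola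
  0≤q²𝔼 = *-nonNeg (*-nonNeg (fromℕ-nonNeg (suc n)) (fromℕ-nonNeg (suc n)))
                   (𝔼-nonNeg parabola 0≤parabola)

lemma11 : (k : ℕ) → 2 ∣ k →
    ¬ (Σ (Distribution k) λ D →
         BalancedPairwiseIndependent D
         × (∀ (x : Point k) → Distribution.μ D x ≢ 0ℚ → ¬ (2 ∣ countZeros x)))
lemma11 zero          _    (D , _ , odd-on-support) =
  odd-on-support _ (λ μ≡0 → ℚₚ.1≢0 (trans (sym (Distribution.total D)) μ≡0)) (2 ∣0)
lemma11 (suc zero)    2∣1  _ with ∣1⇒≡1 2∣1
... | ()
lemma11 (suc (suc n)) even (D , balanced , odd-on-support) =
  no-balanced-with-odd-support D balanced even odd-on-support
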